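{- Let $p$ be a prime of the form $p=4k+1$. If there exist positive integers $d,u,v$ such that $(du,dv,duv)$ is a solution for $p$, i.e. $\frac{4}{p}=\frac{1}{du}+\frac{1}{dv}+\frac{1}{duv}$, then this solution is of Type II.
   Context: For a positive integer $a$, a solution for $a$ is a triple of positive integers $(x,y,z)$ with $\frac{4}{a}=\frac1x+\frac1y+\frac1z$. A solution is of Type II if, after arranging its entries in nondecreasing order $x\le y\le z$, one has $\gcd(a,x)=1$ and $\gcd(a,y)=\gcd(a,z)=a$ (i.e. $a\mid y$ and $a\mid z$). -}

module Defs where

open import Data.Nat using (ℕ; _+_; _*_; _≤_)
open import Data.Nat.Divisibility using (_∣_)
open import Data.Nat.GCD using (gcd)
open import Data.Product using (_×_; _,_; Σ)
open import Data.Sum using (_⊎_)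
open import Relation.Binary.PropositionalEquality using (_≡_)

-- (x,y,z) is a solution for a:  4/a = 1/x + 1/y + 1/z, with a,x,y,z positive.
-- Cleared of denominators (valid since all are positive): 4xyz = a(yz + xz + xy).
Solution : ℕ → ℕ → ℕ → ℕ → Set
Solution a x y z = 4 * x * y * z ≡ a * (y * z + x * z + x * y)

IsPerm : ℕ → ℕ → ℕ → ℕ → ℕ → ℕ → Set
IsPerm x y z x' y' z' =
  ((x' ≡ x) × (y' ≡ y) × (z' ≡ z)) ⊎
  ((x' ≡ x) × (y' ≡ z) × (z' ≡ y)) ⊎
  ((x' ≡ y) × (y' ≡ x) × (z' ≡ z)) ⊎
  ((x' ≡ y) × (y' ≡ z) × (z' ≡ x)) ⊎
  ((x' ≡ z) × (y' ≡ x) × (z' ≡ y)) ⊎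
  ((x' ≡ z) × (y' ≡ y) × (z' ≡ x))

-- Type II: after arranging the entries in nondecreasing order x' ≤ y' ≤ z',
-- gcd(a,x') = 1, a ∣ y', a ∣ z'. (The nondecreasing arrangement is unique as
-- a triple of values, so quantifying over all such arrangements is faithful.)
TypeII : ℕ → ℕ → ℕ → ℕ → Set
TypeII a x y z = ∀ x' y' z' → IsPerm x y z x' y' z' → x' ≤ y' → y' ≤ z' →
  (gcd a x' ≡ 1) × (a ∣ y') × (a ∣ z')

{-# OPTIONS --safe #-}
module Submission where

-- Clearing denominators, the solution (du, dv, duv) says 4duv = p(u + v + 1).
-- The prime p divides neither 4 (as p ≡ 1 mod 4) nor d (if d = ep then
-- 4euv = u + v + 1, too large on the left), so p divides u or v; by symmetry
-- say v = wp. Then 4duw = u + v + 1 shows that p ∤ u (else p ∣ 1) and, again by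
-- size, u < v. Hence du is the strict minimum of the triple and is prime to p,
-- while p divides dv and duv.

open import Defs
open import Data.Nat using (ℕ; zero; suc; _+_; _*_; _<_; NonZero; >-nonZero; >-nonZero⁻¹; nonTrivial⇒≢1)
open import Data.Nat.Properties
open import Data.Nat.Divisibility
open import Data.Nat.GCD using (gcd)
open import Data.Nat.Coprimality using (Coprime; coprime⇒gcd≡1; coprime-divisor)
open import Data.Nat.Primality using (Prime; euclidsLemma; prime⇒nonZero; prime⇒nonTrivial; prime⇒irreducible)
open import Data.Nat.Solver using (module +-*-Solver)
open import Data.Empty using (⊥-elim)
open import Data.Product using (_,_)
open import Data.Sum using (_⊎_; inj₁; inj₂; [_,_]′)
open import Function using (_∘_)
open import Relation.Nullary using (¬_)
open import Relation.Binary.PropositionalEquality using (_≡_; _≢_; refl; sym; trans; cong; subst; module ≡-Reasoning)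
open +-*-Solver using (solve; _:+_; _:*_; _:=_; con)

typeII-swap : ∀ {a x y z} → TypeII a x y z → TypeII a y x z
typeII-swap t x' y' z' (inj₁ π) = t x' y' z' (inj₂ (inj₂ (inj₁ π)))
typeII-swap t x' y' z' (inj₂ (inj₁ π)) = t x' y' z' (inj₂ (inj₂ (inj₂ (inj₁ π))))
typeII-swap t x' y' z' (inj₂ (inj₂ (inj₁ π))) = t x' y' z' (inj₁ π)
typeII-swap t x' y' z' (inj₂ (inj₂ (inj₂ (inj₁ π)))) = t x' y' z' (inj₂ (inj₁ π))
typeII-swap t x' y' z' (inj₂ (inj₂ (inj₂ (inj₂ (inj₁ π))))) = t x' y' z' (inj₂ (inj₂ (inj₂ (inj₂ (inj₂ π)))))
typeII-swap t x' y' z' (inj₂ (inj₂ (inj₂ (inj₂ (inj₂ π))))) = t x' y' z' (inj₂ (inj₂ (inj₂ (inj₂ (inj₁ π)))))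

typeII-strictMin : ∀ {a x y z} → gcd a x ≡ 1 → a ∣ y → a ∣ z → x < y → x < z → TypeII a x y z
typeII-strictMin g a∣y a∣z x<y x<z _ _ _ (inj₁ (refl , refl , refl)) _ _ = g , a∣y , a∣z
typeII-strictMin g a∣y a∣z x<y x<z _ _ _ (inj₂ (inj₁ (refl , refl , refl))) _ _ = g , a∣z , a∣y
typeII-strictMin g a∣y a∣z x<y x<z _ _ _ (inj₂ (inj₂ (inj₁ (refl , refl , refl)))) y≤x _ = ⊥-elim (<⇒≱ x<y y≤x)
typeII-strictMin g a∣y a∣z x<y x<z _ _ _ (inj₂ (inj₂ (inj₂ (inj₁ (refl , refl , refl))))) y≤z z≤x = ⊥-elim (<⇒≱ x<y (≤-trans y≤z z≤x))
typeII-strictMin g a∣y a∣z x<y x<z _ _ _ (inj₂ (inj₂ (inj₂ (inj₂ (inj₁ (refl , refl , refl)))))) z≤x _ = ⊥-elim (<⇒≱ x<z z≤x)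
typeII-strictMin g a∣y a∣z x<y x<z _ _ _ (inj₂ (inj₂ (inj₂ (inj₂ (inj₂ (refl , refl , refl)))))) z≤y y≤x = ⊥-elim (<⇒≱ x<z (≤-trans z≤y y≤x))

solution⇒4duv≡a[u+v+1] : ∀ a d u v .{{_ : NonZero d}} .{{_ : NonZero u}} .{{_ : NonZero v}} →
  Solution a (d * u) (d * v) (d * u * v) → 4 * d * u * v ≡ a * (u + v + 1)
solution⇒4duv≡a[u+v+1] a d u v sol = *-cancelˡ-≡ _ _ (d * d * u * v) {{ddu*v≢0}} (begin
  d * d * u * v * (4 * d * u * v)
    ≡⟨ solve 3 (λ d u v → d :* d :* u :* v :* (con 4 :* d :* u :* v)
                       := con 4 :* (d :* u) :* (d :* v) :* (d :* u :* v)) refl d u v ⟩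
  4 * (d * u) * (d * v) * (d * u * v)
    ≡⟨ sol ⟩
  a * (d * v * (d * u * v) + d * u * (d * u * v) + d * u * (d * v))
    ≡⟨ solve 4 (λ a d u v → a :* (d :* v :* (d :* u :* v) :+ d :* u :* (d :* u :* v) :+ d :* u :* (d :* v))
                         := d :* d :* u :* v :* (a :* (u :+ v :+ con 1))) refl a d u v ⟩
  d * d * u * v * (a * (u + v + 1))
    ∎)
  where
  open ≡-Reasoning
  ddu*v≢0 : NonZero (d * d * u * v)
  ddu*v≢0 = m*n≢0 (d * d * u) v {{m*n≢0 (d * d) u {{m*n≢0 d d}}}}

*-cancel-divisor : ∀ {p} m n s .{{_ : NonZero p}} (p∣n : p ∣ n) → m * n ≡ p * s → m * quotient p∣n ≡ s
*-cancel-divisor {p} m n s (divides q refl) eq = *-cancelˡ-≡ _ _ p (begin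
  p * (m * q) ≡⟨ solve 3 (λ p m q → p :* (m :* q) := m :* (q :* p)) refl p m q ⟩
  m * (q * p) ≡⟨ eq ⟩
  p * s       ∎)
  where open ≡-Reasoning

4cm≡m+n+1⇒m<n : ∀ c m n .{{_ : NonZero c}} .{{_ : NonZero m}} → 4 * c * m ≡ m + n + 1 → m < n
4cm≡m+n+1⇒m<n c m n eq = ≰⇒> λ n≤m → <-irrefl (sym eq) (begin-strict
  m + n + 1     ≤⟨ +-monoˡ-≤ 1 (+-monoʳ-≤ m n≤m) ⟩
  m + m + 1     ≤⟨ +-monoʳ-≤ (m + m) (>-nonZero⁻¹ m) ⟩
  m + m + m     <⟨ m<m+n (m + m + m) (>-nonZero⁻¹ m) ⟩
  m + m + m + m ≡⟨ solve 1 (λ m → m :+ m :+ m :+ m := con 4 :* m) refl m ⟩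
  4 * m         ≤⟨ *-monoˡ-≤ m (m≤m*n 4 c) ⟩
  4 * c * m     ∎)
  where open ≤-Reasoning

module _ {p : ℕ} (p-prime : Prime p) where

  private instance
    p≢0 : NonZero p
    p≢0 = prime⇒nonZero p-prime

  prime≢1 : p ≢ 1
  prime≢1 = nonTrivial⇒≢1 {{prime⇒nonTrivial p-prime}}

  prime∤1 : ¬ p ∣ 1
  prime∤1 = prime≢1 ∘ ∣1⇒≡1

  prime∤* : ∀ {m n} → ¬ p ∣ m → ¬ p ∣ n → ¬ p ∣ m * n
  prime∤* {m} {n} p∤m p∤n = [ p∤m , p∤n ]′ ∘ euclidsLemma m n p-prime

  prime∤⇒coprime : ∀ {n} → ¬ p ∣ n → Coprime p n
  prime∤⇒coprime p∤n (d∣p , d∣n) with prime⇒irreducible p-prime d∣p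
  ... | inj₁ d≡1 = d≡1
  ... | inj₂ refl = ⊥-elim (p∤n d∣n)

  prime≡4k+1⇒∤4 : ∀ k → p ≡ 4 * k + 1 → ¬ p ∣ 4
  prime≡4k+1⇒∤4 zero refl _ = prime≢1 refl
  prime≡4k+1⇒∤4 (suc k) refl p∣4 = <⇒≱ 4<p (∣⇒≤ p∣4)
    where
    4<p : 4 < 4 * suc k + 1
    4<p = +-monoˡ-≤ 1 (m≤m*n 4 (suc k))

  prime∣u⊎prime∣v : ∀ {d u v s} → ¬ p ∣ 4 * d → 4 * d * u * v ≡ p * s → p ∣ u ⊎ p ∣ v
  prime∣u⊎prime∣v {d} {u} {v} {s} p∤4d eq =
    euclidsLemma u v p-prime (coprime-divisor (prime∤⇒coprime p∤4d) (divides s (begin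
      4 * d * (u * v) ≡⟨ *-assoc (4 * d) u v ⟨
      4 * d * u * v   ≡⟨ eq ⟩
      p * s           ≡⟨ *-comm p s ⟩
      s * p           ∎)))
    where open ≡-Reasoning

  module _ {d u v : ℕ} .{{_ : NonZero d}} .{{_ : NonZero u}} .{{_ : NonZero v}} where

    prime∤d : 4 * d * u * v ≡ p * (u + v + 1) → ¬ p ∣ d
    prime∤d eq p∣d = <-asym (4cm≡m+n+1⇒m<n (e * v) u v {{m*n≢0 e v}} reducedᵤ)
                            (4cm≡m+n+1⇒m<n (e * u) v u {{m*n≢0 e u}} reducedᵥ)
      where
      open ≡-Reasoning
      e : ℕ
      e = quotient p∣d
      instance
        e≢0 : NonZero e
        e≢0 = quotient≢0 p∣d
      reduced : 4 * u * v * e ≡ u + v + 1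
      reduced = *-cancel-divisor (4 * u * v) d (u + v + 1) p∣d (begin
        4 * u * v * d ≡⟨ solve 3 (λ d u v → con 4 :* u :* v :* d := con 4 :* d :* u :* v) refl d u v ⟩
        4 * d * u * v ≡⟨ eq ⟩
        p * (u + v + 1) ∎)
      reducedᵤ : 4 * (e * v) * u ≡ u + v + 1
      reducedᵤ = trans (solve 3 (λ e u v → con 4 :* (e :* v) :* u := con 4 :* u :* v :* e) refl e u v) reduced
      reducedᵥ : 4 * (e * u) * v ≡ v + u + 1
      reducedᵥ = begin
        4 * (e * u) * v ≡⟨ solve 3 (λ e u v → con 4 :* (e :* u) :* v := con 4 :* u :* v :* e) refl e u v ⟩
        4 * u * v * e   ≡⟨ reduced ⟩
        u + v + 1       ≡⟨ cong (_+ 1) (+-comm u v) ⟩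
        v + u + 1       ∎

    typeII-of-∣v : ¬ p ∣ d → 4 * d * u * v ≡ p * (u + v + 1) → p ∣ v → TypeII p (d * u) (d * v) (d * u * v)
    typeII-of-∣v p∤d eq p∣v =
      typeII-strictMin (coprime⇒gcd≡1 (prime∤⇒coprime (prime∤* p∤d p∤u)))
        (∣n⇒∣m*n d p∣v) (∣n⇒∣m*n (d * u) p∣v)
        (*-monoʳ-< d u<v) (m<m*n (d * u) v {{m*n≢0 d u}} 1<v)
      where
      w : ℕ
      w = quotient p∣v
      instance
        w≢0 : NonZero w
        w≢0 = quotient≢0 p∣v
      reduced : 4 * d * u * w ≡ u + v + 1
      reduced = *-cancel-divisor (4 * d * u) v (u + v + 1) p∣v eq
      p∤u : ¬ p ∣ u
      p∤u p∣u = prime∤1 (∣m+n∣m⇒∣n (subst (p ∣_) reduced (∣m⇒∣m*n w (∣n⇒∣m*n (4 * d) p∣u)))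
                                    (∣m∣n⇒∣m+n p∣u p∣v))
      u<v : u < v
      u<v = 4cm≡m+n+1⇒m<n (d * w) u v {{m*n≢0 d w}}
              (trans (solve 3 (λ d u w → con 4 :* (d :* w) :* u := con 4 :* d :* u :* w) refl d u w) reduced)
      1<v : 1 < v
      1<v = ≤-<-trans (>-nonZero⁻¹ u) u<v

  typeII-of-∣u : ∀ {d u v} .{{_ : NonZero d}} .{{_ : NonZero u}} .{{_ : NonZero v}} →
                 ¬ p ∣ d → 4 * d * u * v ≡ p * (u + v + 1) → p ∣ u → TypeII p (d * u) (d * v) (d * u * v)
  typeII-of-∣u {d} {u} {v} p∤d eq p∣u =
    subst (TypeII p (d * u) (d * v)) dvu≡duv
      (typeII-swap (typeII-of-∣v {d} {v} {u} p∤d eq′ p∣u))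
    where
    eq′ : 4 * d * v * u ≡ p * (v + u + 1)
    eq′ = trans (solve 3 (λ d u v → con 4 :* d :* v :* u := con 4 :* d :* u :* v) refl d u v)
                (trans eq (cong (λ s → p * (s + 1)) (+-comm u v)))
    dvu≡duv : d * v * u ≡ d * u * v
    dvu≡duv = solve 3 (λ d u v → d :* v :* u := d :* u :* v) refl d u v

theorem2 : (p k d u v : ℕ) → Prime p → p ≡ 4 * k + 1 →
    0 < d → 0 < u → 0 < v →
    Solution p (d * u) (d * v) (d * u * v) →
    TypeII p (d * u) (d * v) (d * u * v)
theorem2 p k d u v p-prime p≡4k+1 0<d 0<u 0<v sol =
  [ typeII-of-∣u p-prime p∤d eq , typeII-of-∣v p-prime p∤d eq ]′ (prime∣u⊎prime∣v p-prime {d} p∤4d eq)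
  where
  instance
    d≢0 : NonZero d
    d≢0 = >-nonZero 0<d
    u≢0 : NonZero u
    u≢0 = >-nonZero 0<u
    v≢0 : NonZero v
    v≢0 = >-nonZero 0<v
  eq : 4 * d * u * v ≡ p * (u + v + 1)
  eq = solution⇒4duv≡a[u+v+1] p d u v sol
  p∤d : ¬ p ∣ d
  p∤d = prime∤d p-prime {d} eq
  p∤4d : ¬ p ∣ 4 * d
  p∤4d = prime∤* p-prime (prime≡4k+1⇒∤4 p-prime k p≡4k+1) p∤d
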